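{- If $X$ is a finite simple group having an asymmetric generating pair, then $X$ is (isomorphic to) the monodromy group of a totally chiral hypermap.
   Context: A generating pair $x,y$ of a group $G$ (i.e. $G=\langle x,y\rangle$) is symmetric if some automorphism of $G$ sends $x\mapsto x^{ -1}$ and $y\mapsto y^{ -1}$, and asymmetric otherwise. Let $\Delta=\langle r_0,r_1,r_2\mid r_0^2=r_1^2=r_2^2=1\rangle$ and let $\Delta^+$ be its index-$2$ subgroup of even-length words, generated by $\rho=r_1r_2$ and $\lambda=r_2r_0$. An (oriented) hypermap is a triple $\mathcal H=(D,R,L)$ with $D$ a finite set and $R,L$ permutations of $D$ such that the monodromy group $\mathrm{Mon}(\mathcal H)=\langle R,L\rangle$ is transitive on $D$. It is orientably regular if its automorphism group (permutations of $D$ commuting with $R$ and $L$) acts regularly on $D$; then $\mathcal H\cong(\Delta^+/H,\rho,\lambda)$ for a unique normal subgroup $H$ of finite index in $\Delta^+$, and $\mathrm{Mon}(\mathcal H)\cong\Delta^+/H$. For $H\trianglelefteq\Delta^+$ put $H^r=r_2Hr_2$. An orientably regular hypermap is totally chiral if $HH^r=\Delta^+$. -}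

module Defs where

open import Level using (Level; _⊔_) renaming (suc to lsuc)
open import Data.Nat using (ℕ)
open import Data.Fin using (Fin; zero; suc; _≟_)
open import Data.Fin.Permutation using (Permutation′; _⟨$⟩ʳ_; _⟨$⟩ˡ_)
open import Data.List using (List; []; _∷_; _++_; [_]; length)
open import Data.Bool using (Bool; true; false)
open import Data.Nat.Divisibility using (_∣_)
open import Data.Product using (Σ; ∃; _×_; _,_)
open import Data.Sum using (_⊎_)
open import Relation.Nullary using (¬_; yes; no)
open import Relation.Binary.PropositionalEquality using (_≡_)
open import Function using (_∘_; id)
open import Algebra.Bundles using (Group)

module _ {c ℓ : Level} (G : Group c ℓ) where
  open Group G

  IsFiniteGroup : Set (c ⊔ ℓ)
  IsFiniteGroup = Σ ℕ λ n → Σ (Fin n → Carrier) λ f → ∀ a → Σ (Fin n) λ i → a ≈ f i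

  record IsNormalSubgroup (N : Carrier → Set (c ⊔ ℓ)) : Set (c ⊔ ℓ) where
    field
      resp  : ∀ {a b} → a ≈ b → N a → N b
      has-ε : N ε
      ∙-closed : ∀ {a b} → N a → N b → N (a ∙ b)
      ⁻¹-closed : ∀ {a} → N a → N (a ⁻¹)
      conj-closed : ∀ g {a} → N a → N ((g ∙ a) ∙ (g ⁻¹))

  IsSimpleGroup : Set (lsuc (c ⊔ ℓ))
  IsSimpleGroup =
    (Σ Carrier λ a → ¬ (a ≈ ε)) ×
    ((N : Carrier → Set (c ⊔ ℓ)) → IsNormalSubgroup N →
       (∀ a → N a → a ≈ ε) ⊎ (∀ a → N a))

  eval₂ : Carrier → Carrier → List (Fin 2 × Bool) → Carrier
  eval₂ x y [] = ε
  eval₂ x y ((zero , true) ∷ w) = x ∙ eval₂ x y w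
  eval₂ x y ((zero , false) ∷ w) = (x ⁻¹) ∙ eval₂ x y w
  eval₂ x y ((suc _ , true) ∷ w) = y ∙ eval₂ x y w
  eval₂ x y ((suc _ , false) ∷ w) = (y ⁻¹) ∙ eval₂ x y w

  Generates : Carrier → Carrier → Set (c ⊔ ℓ)
  Generates x y = ∀ a → Σ (List (Fin 2 × Bool)) λ w → a ≈ eval₂ x y w

  record IsAutomorphism (f : Carrier → Carrier) : Set (c ⊔ ℓ) where
    field
      cong-f : ∀ {a b} → a ≈ b → f a ≈ f b
      hom    : ∀ a b → f (a ∙ b) ≈ f a ∙ f b
      inj    : ∀ {a b} → f a ≈ f b → a ≈ b
      surj   : ∀ b → Σ Carrier λ a → f a ≈ b

  IsSymmetricPair : Carrier → Carrier → Set (c ⊔ ℓ)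
  IsSymmetricPair x y = Σ (Carrier → Carrier) λ f →
    IsAutomorphism f × (f x ≈ x ⁻¹) × (f y ≈ y ⁻¹)

  HasAsymmetricGeneratingPair : Set (c ⊔ ℓ)
  HasAsymmetricGeneratingPair =
    Σ Carrier λ x → Σ Carrier λ y → Generates x y × ¬ IsSymmetricPair x y

-- The extended triangle group Δ = ⟨ r₀ , r₁ , r₂ | rᵢ² ⟩.
-- Elements are words over Fin 3 (letter i = rᵢ); two words denote the same
-- element iff they have the same free normal form (cancel adjacent equal
-- letters).

ΔWord : Set
ΔWord = List (Fin 3)

consR : Fin 3 → ΔWord → ΔWord
consR a [] = a ∷ []
consR a (b ∷ w) with a ≟ b
... | yes _ = w
... | no _  = a ∷ b ∷ w

normal : ΔWord → ΔWord
normal [] = []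
normal (a ∷ w) = consR a (normal w)

_≈Δ_ : ΔWord → ΔWord → Set
u ≈Δ v = normal u ≡ normal v

-- membership in Δ⁺ (even-length words)
IsEven : ΔWord → Set
IsEven w = 2 ∣ length w

r₀ r₁ r₂ : Fin 3
r₀ = zero
r₁ = suc zero
r₂ = suc (suc zero)

ρΔ λΔ : ΔWord
ρΔ = r₁ ∷ r₂ ∷ []
λΔ = r₂ ∷ r₀ ∷ []

-- Oriented hypermaps on darts Fin n, and the action of Δ⁺ on the darts
-- via ρ ↦ R , λ ↦ L (composition: (w v) acts as (act w) ∘ (act v)).

record Hypermap : Set where
  constructor hypermap
  field
    size : ℕ
    R L  : Permutation′ size

module _ (H : Hypermap) where
  open Hypermap H

  -- Δ⁺ → Sym(darts) is given by rᵢ rⱼ ↦ sᵢ ∘ sⱼ⁻¹ with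
  -- s₀ = L⁻¹ , s₁ = R , s₂ = 1 ; so ρ = r₁r₂ ↦ R , λ = r₂r₀ ↦ L.
  -- sInv j = sⱼ⁻¹
  sInv : Fin 3 → Fin size → Fin size
  sInv zero = L ⟨$⟩ʳ_
  sInv (suc zero) = R ⟨$⟩ˡ_
  sInv (suc (suc _)) = id

  pairAct : Fin 3 → Fin 3 → Fin size → Fin size
  pairAct zero j = (L ⟨$⟩ˡ_) ∘ sInv j
  pairAct (suc zero) j = (R ⟨$⟩ʳ_) ∘ sInv j
  pairAct (suc (suc _)) j = sInv j

  act : ΔWord → Fin size → Fin size
  act [] = id
  act (a ∷ []) = id
  act (a ∷ b ∷ w) = pairAct a b ∘ act w

  IsTransitive : Set
  IsTransitive = ∀ d d′ → Σ ΔWord λ w → IsEven w × (act w d ≡ d′)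

  IsHypermapAut : Permutation′ size → Set
  IsHypermapAut σ = ∀ d → (σ ⟨$⟩ʳ (R ⟨$⟩ʳ d) ≡ R ⟨$⟩ʳ (σ ⟨$⟩ʳ d))
                        × (σ ⟨$⟩ʳ (L ⟨$⟩ʳ d) ≡ L ⟨$⟩ʳ (σ ⟨$⟩ʳ d))

  IsOrientablyRegular : Set
  IsOrientablyRegular =
    (∀ d d′ → Σ (Permutation′ size) λ σ → IsHypermapAut σ × (σ ⟨$⟩ʳ d ≡ d′)) ×
    (∀ σ d → IsHypermapAut σ → σ ⟨$⟩ʳ d ≡ d → ∀ e → σ ⟨$⟩ʳ e ≡ e)

  -- H = kernel of Δ⁺ → Mon(H)  (= dart stabiliser, as H is regular)
  InH : ΔWord → Set
  InH w = IsEven w × (∀ d → act w d ≡ d)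

  InHr : ΔWord → Set
  InHr w = IsEven w × InH (r₂ ∷ w ++ [ r₂ ])

  IsTotallyChiral : Set
  IsTotallyChiral = IsOrientablyRegular ×
    (∀ w → IsEven w → Σ ΔWord λ h → Σ ΔWord λ k →
       InH h × InHr k × (w ≈Δ (h ++ k)))

  MonIsomorphicTo : ∀ {c ℓ} → Group c ℓ → Set (c ⊔ ℓ)
  MonIsomorphicTo G = Σ (Carrier → Fin size → Fin size) λ φ →
      (∀ {a b} → a ≈ b → ∀ d → φ a d ≡ φ b d)
    × (∀ a b d → φ (a ∙ b) d ≡ φ a (φ b d))
    × (∀ {a b} → (∀ d → φ a d ≡ φ b d) → a ≈ b)
    × (∀ a → Σ ΔWord λ w → IsEven w × (∀ d → φ a d ≡ act w d))
    × (∀ w → IsEven w → Σ Carrier λ a → ∀ d → act w d ≡ φ a d)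
    where open Group G

{-# OPTIONS --safe #-}
module Submission where

-- Take the elements of X as darts, with R and L left multiplication by x and y.  Then
-- Mon ≅ X acts regularly (its centraliser is X acting on the right), and H is the kernel
-- of P : Δ⁺ → X, ρ ↦ x, λ ↦ y, while H^r is the kernel of Q = P ∘ (conjugation by r₂),
-- ρ ↦ x⁻¹, λ ↦ y⁻¹.  The image P(ker Q) is normal in X.  Were it trivial, P would factor
-- as G ∘ Q with G a surjective, hence (X simple) bijective, endomorphism inverting x and
-- y, contradicting asymmetry.  So P(ker Q) = X: every w ∈ Δ⁺ has some k ∈ ker Q with
-- P k = P w, and w = (w k⁻¹) k ∈ H H^r.
-- Constructively, simplicity of X also gives excluded middle (apply it to the normal
-- subgroup {a | a = 1 ∨ A} for a proposition A), hence decidable equality, which is what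
-- allows the finite enumeration of X to be deduplicated into the dart set Fin m.

open import Defs
open import Level using (Level; _⊔_; Lift; lift; lower)
open import Data.Nat using (ℕ; zero; suc; _+_)
open import Data.Nat.Properties using (suc-injective)
open import Data.Nat.Divisibility using (divides)
open import Data.Fin using (Fin; zero; suc; _≟_)
open import Data.Fin.Properties using (any?)
open import Data.Fin.Permutation using (Permutation′; _⟨$⟩ʳ_; _⟨$⟩ˡ_; permutation)
import Data.Fin.Permutation as Perm
open import Data.Vec.Functional using () renaming (_∷_ to _◂_)
open import Data.List using ([]; _∷_; _++_; [_]; reverse)
open import Data.List.Properties using (++-assoc; ++-identityʳ; reverse-++)
open import Data.Bool using (true; false)
open import Data.Product using (Σ; _×_; _,_; proj₁; proj₂)
open import Data.Sum using (_⊎_; inj₁; inj₂; map₁)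
open import Data.Empty using (⊥-elim)
open import Relation.Nullary using (¬_; yes; no)
open import Relation.Binary.Definitions using (Decidable)
open import Relation.Binary.Bundles using (Setoid)
import Relation.Binary.PropositionalEquality as ≡
open ≡ using (_≡_; _≢_)
open import Function using (id; _∘_)
open import Algebra.Bundles using (Group)

data Even : ΔWord → Set where
  nil   : Even []
  cons₂ : ∀ a b {w} → Even w → Even (a ∷ b ∷ w)

Even⇒IsEven : ∀ {w} → Even w → IsEven w
Even⇒IsEven nil = divides 0 ≡.refl
Even⇒IsEven (cons₂ a b e) with Even⇒IsEven e
... | divides q eq = divides (suc q) (≡.cong (2 +_) eq)

IsEven⇒Even : ∀ w → IsEven w → Even w
IsEven⇒Even [] _ = nil
IsEven⇒Even (a ∷ []) (divides zero ())
IsEven⇒Even (a ∷ []) (divides (suc q) ())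
IsEven⇒Even (a ∷ b ∷ w) (divides zero ())
IsEven⇒Even (a ∷ b ∷ w) (divides (suc q) eq) =
  cons₂ a b (IsEven⇒Even w (divides q (suc-injective (suc-injective eq))))

Even-++ : ∀ {u v} → Even u → Even v → Even (u ++ v)
Even-++ nil ev = ev
Even-++ (cons₂ a b eu) ev = cons₂ a b (Even-++ eu ev)

reverse-∷₂ : ∀ (a b : Fin 3) w → reverse (a ∷ b ∷ w) ≡ reverse w ++ b ∷ a ∷ []
reverse-∷₂ a b w = reverse-++ (a ∷ b ∷ []) w

Even-reverse : ∀ {w} → Even w → Even (reverse w)
Even-reverse nil = nil
Even-reverse (cons₂ a b {w} e) =
  ≡.subst Even (≡.sym (reverse-∷₂ a b w)) (Even-++ (Even-reverse e) (cons₂ b a nil))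

Even-wrap : ∀ c d {k} → Even k → Even (c ∷ k ++ [ d ])
Even-wrap c d nil = cons₂ c d nil
Even-wrap c d (cons₂ a b e) = cons₂ c a (Even-wrap b d e)

data Reduced : ΔWord → Set where
  empty  : Reduced []
  single : ∀ a → Reduced [ a ]
  cons   : ∀ {a b w} → a ≢ b → Reduced (b ∷ w) → Reduced (a ∷ b ∷ w)

Reduced-tail : ∀ {a w} → Reduced (a ∷ w) → Reduced w
Reduced-tail (single _) = empty
Reduced-tail (cons _ r) = r

consR-reduced : ∀ a {v} → Reduced v → Reduced (consR a v)
consR-reduced a empty = single a
consR-reduced a {b ∷ w} r with a ≟ b
... | yes _ = Reduced-tail r
... | no a≢b = cons a≢b r

normal-reduced : ∀ w → Reduced (normal w)
normal-reduced [] = empty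
normal-reduced (a ∷ w) = consR-reduced a (normal-reduced w)

consR-involutive : ∀ a {v} → Reduced v → consR a (consR a v) ≡ v
consR-involutive a empty with a ≟ a
... | yes _ = ≡.refl
... | no a≢a = ⊥-elim (a≢a ≡.refl)
consR-involutive a {b ∷ w} r with a ≟ b
consR-involutive a {b ∷ []} r | yes ≡.refl = ≡.refl
consR-involutive a {b ∷ c ∷ w} (cons b≢c _) | yes ≡.refl with a ≟ c
... | yes ≡.refl = ⊥-elim (b≢c ≡.refl)
... | no _ = ≡.refl
consR-involutive a {b ∷ w} r | no _ with a ≟ a
... | yes _ = ≡.refl
... | no a≢a = ⊥-elim (a≢a ≡.refl)

normal-cancel : ∀ a v → normal (a ∷ a ∷ v) ≡ normal v
normal-cancel a v = consR-involutive a (normal-reduced v)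

≈Δ-congˡ : ∀ z {v v′} → v ≈Δ v′ → (z ++ v) ≈Δ (z ++ v′)
≈Δ-congˡ [] eq = eq
≈Δ-congˡ (a ∷ z) eq = ≡.cong (consR a) (≈Δ-congˡ z eq)

reverse-++-cancel : ∀ k → (reverse k ++ k) ≈Δ []
reverse-++-cancel [] = ≡.refl
reverse-++-cancel (a ∷ k) = begin
  normal (reverse (a ∷ k) ++ a ∷ k)     ≡⟨ ≡.cong (λ u → normal (u ++ a ∷ k)) (reverse-++ [ a ] k) ⟩
  normal ((reverse k ++ [ a ]) ++ a ∷ k) ≡⟨ ≡.cong normal (++-assoc (reverse k) [ a ] (a ∷ k)) ⟩
  normal (reverse k ++ a ∷ a ∷ k)       ≡⟨ ≈Δ-congˡ (reverse k) (normal-cancel a k) ⟩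
  normal (reverse k ++ k)               ≡⟨ reverse-++-cancel k ⟩
  []                                    ∎
  where open ≡.≡-Reasoning

≈Δ-split : ∀ w k → w ≈Δ ((w ++ reverse k) ++ k)
≈Δ-split w k = ≡.sym (begin
  normal ((w ++ reverse k) ++ k) ≡⟨ ≡.cong normal (++-assoc w (reverse k) k) ⟩
  normal (w ++ reverse k ++ k)   ≡⟨ ≈Δ-congˡ w (reverse-++-cancel k) ⟩
  normal (w ++ [])               ≡⟨ ≡.cong normal (++-identityʳ w) ⟩
  normal w                       ∎)
  where open ≡.≡-Reasoning

Commute : ∀ {n} → Permutation′ n → Permutation′ n → Set
Commute σ π = ∀ e → σ ⟨$⟩ʳ (π ⟨$⟩ʳ e) ≡ π ⟨$⟩ʳ (σ ⟨$⟩ʳ e)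

commute-inverse : ∀ {n} (σ π : Permutation′ n) → Commute σ π →
                  ∀ e → σ ⟨$⟩ʳ (π ⟨$⟩ˡ e) ≡ π ⟨$⟩ˡ (σ ⟨$⟩ʳ e)
commute-inverse σ π σπ≡πσ e = begin
  σ ⟨$⟩ʳ (π ⟨$⟩ˡ e)                       ≡⟨ Perm.inverseˡ π ⟨
  π ⟨$⟩ˡ (π ⟨$⟩ʳ (σ ⟨$⟩ʳ (π ⟨$⟩ˡ e)))     ≡⟨ ≡.cong (π ⟨$⟩ˡ_) (σπ≡πσ (π ⟨$⟩ˡ e)) ⟨
  π ⟨$⟩ˡ (σ ⟨$⟩ʳ (π ⟨$⟩ʳ (π ⟨$⟩ˡ e)))     ≡⟨ ≡.cong (λ d → π ⟨$⟩ˡ (σ ⟨$⟩ʳ d)) (Perm.inverseʳ π) ⟩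
  π ⟨$⟩ˡ (σ ⟨$⟩ʳ e)                       ∎
  where open ≡.≡-Reasoning

module _ (𝓗 : Hypermap) where
  open Hypermap 𝓗

  module _ {σ : Permutation′ size} (σ-aut : IsHypermapAut 𝓗 σ) where
    private
      σR≡Rσ : Commute σ R
      σR≡Rσ e = proj₁ (σ-aut e)
      σL≡Lσ : Commute σ L
      σL≡Lσ e = proj₂ (σ-aut e)

    aut-commutes-sInv : ∀ j e → σ ⟨$⟩ʳ sInv 𝓗 j e ≡ sInv 𝓗 j (σ ⟨$⟩ʳ e)
    aut-commutes-sInv zero e = σL≡Lσ e
    aut-commutes-sInv (suc zero) e = commute-inverse σ R σR≡Rσ e
    aut-commutes-sInv (suc (suc _)) e = ≡.refl

    aut-commutes-pairAct : ∀ a b e → σ ⟨$⟩ʳ pairAct 𝓗 a b e ≡ pairAct 𝓗 a b (σ ⟨$⟩ʳ e)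
    aut-commutes-pairAct zero b e =
      ≡.trans (commute-inverse σ L σL≡Lσ _) (≡.cong (L ⟨$⟩ˡ_) (aut-commutes-sInv b e))
    aut-commutes-pairAct (suc zero) b e =
      ≡.trans (σR≡Rσ _) (≡.cong (R ⟨$⟩ʳ_) (aut-commutes-sInv b e))
    aut-commutes-pairAct (suc (suc _)) b e = aut-commutes-sInv b e

    aut-commutes-act : ∀ w e → σ ⟨$⟩ʳ act 𝓗 w e ≡ act 𝓗 w (σ ⟨$⟩ʳ e)
    aut-commutes-act [] e = ≡.refl
    aut-commutes-act (a ∷ []) e = ≡.refl
    aut-commutes-act (a ∷ b ∷ w) e =
      ≡.trans (aut-commutes-pairAct a b _) (≡.cong (pairAct 𝓗 a b) (aut-commutes-act w e))

  aut-fixing-dart⇒id : IsTransitive 𝓗 → ∀ {σ} → IsHypermapAut 𝓗 σ →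
                       ∀ {d} → σ ⟨$⟩ʳ d ≡ d → ∀ e → σ ⟨$⟩ʳ e ≡ e
  aut-fixing-dart⇒id transitive {σ} σ-aut {d} σd≡d e = begin
    σ ⟨$⟩ʳ e               ≡⟨ ≡.cong (σ ⟨$⟩ʳ_) w·d≡e ⟨
    σ ⟨$⟩ʳ act 𝓗 w d       ≡⟨ aut-commutes-act {σ} σ-aut w d ⟩
    act 𝓗 w (σ ⟨$⟩ʳ d)     ≡⟨ ≡.cong (act 𝓗 w) σd≡d ⟩
    act 𝓗 w d              ≡⟨ w·d≡e ⟩
    e                      ∎
    where
    open ≡.≡-Reasoning
    w : ΔWord
    w = proj₁ (transitive d e)
    w·d≡e : act 𝓗 w d ≡ e
    w·d≡e = proj₂ (proj₂ (transitive d e))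

record Enumeration {a ℓ} (S : Setoid a ℓ) : Set (a ⊔ ℓ) where
  open Setoid S
  field
    size           : ℕ
    elem           : Fin size → Carrier
    index          : Carrier → Fin size
    elem-index     : ∀ x → elem (index x) ≈ x
    elem-injective : ∀ {i j} → elem i ≈ elem j → i ≡ j

  index-elem : ∀ i → index (elem i) ≡ i
  index-elem i = elem-injective (elem-index (elem i))

  index-cong : ∀ {x y} → x ≈ y → index x ≡ index y
  index-cong {x} {y} x≈y = elem-injective (trans (elem-index x) (trans x≈y (sym (elem-index y))))

  index-injective : ∀ {x y} → index x ≡ index y → x ≈ y
  index-injective {x} {y} eq = trans (sym (elem-index x)) (trans (reflexive (≡.cong elem eq)) (elem-index y))

module _ {a ℓ} (S : Setoid a ℓ) (_≟_ : Decidable (Setoid._≈_ S)) where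
  open Setoid S

  record Deduplication {n} (f : Fin n → Carrier) : Set (a ⊔ ℓ) where
    field
      size           : ℕ
      elem           : Fin size → Carrier
      position       : Fin n → Fin size
      elem-position  : ∀ i → elem (position i) ≈ f i
      elem-injective : ∀ {i j} → elem i ≈ elem j → i ≡ j

  deduplicate : ∀ n (f : Fin n → Carrier) → Deduplication f
  deduplicate zero f = record
    { size = 0
    ; elem = λ ()
    ; position = λ ()
    ; elem-position = λ ()
    ; elem-injective = λ { {()} }
    }
  deduplicate (suc n) f with deduplicate n (f ∘ suc)
  ... | D with any? (λ j → Deduplication.elem D j ≟ f zero)
  ...   | yes (j , elem-j≈f0) = record
    { size = size
    ; elem = elem
    ; position = j ◂ position
    ; elem-position = λ { zero → elem-j≈f0 ; (suc i) → elem-position i }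
    ; elem-injective = elem-injective
    }
    where open Deduplication D
  ...   | no f0∉elem = record
    { size = suc size
    ; elem = f zero ◂ elem
    ; position = zero ◂ (suc ∘ position)
    ; elem-position = λ { zero → refl ; (suc i) → elem-position i }
    ; elem-injective = injective
    }
    where
    open Deduplication D
    injective : ∀ {i j} → (f zero ◂ elem) i ≈ (f zero ◂ elem) j → i ≡ j
    injective {zero} {zero} _ = ≡.refl
    injective {zero} {suc j} e = ⊥-elim (f0∉elem (j , sym e))
    injective {suc i} {zero} e = ⊥-elim (f0∉elem (i , e))
    injective {suc i} {suc j} e = ≡.cong suc (elem-injective e)

  enumerate : ∀ n (f : Fin n → Carrier) → (∀ x → Σ (Fin n) λ i → x ≈ f i) → Enumeration S
  enumerate n f covers = record
    { size = size
    ; elem = elem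
    ; index = λ x → position (proj₁ (covers x))
    ; elem-index = λ x → trans (elem-position _) (sym (proj₂ (covers x)))
    ; elem-injective = elem-injective
    }
    where open Deduplication (deduplicate n f)

module _ {c ℓ} (X : Group c ℓ) where
  open Group X
  open import Algebra.Properties.Group X
  open import Relation.Binary.Reasoning.Setoid setoid

  conj-ε : ∀ g {a} → a ≈ ε → (g ∙ a) ∙ g ⁻¹ ≈ ε
  conj-ε g {a} a≈ε = begin
    (g ∙ a) ∙ g ⁻¹ ≈⟨ ∙-congʳ (∙-congˡ a≈ε) ⟩
    (g ∙ ε) ∙ g ⁻¹ ≈⟨ ∙-congʳ (identityʳ g) ⟩
    g ∙ g ⁻¹       ≈⟨ inverseʳ g ⟩
    ε              ∎

  module Endomorphism {f : Carrier → Carrier}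
           (f-cong : ∀ {a b} → a ≈ b → f a ≈ f b)
           (f-hom : ∀ a b → f (a ∙ b) ≈ f a ∙ f b) where

    ε-homo : f ε ≈ ε
    ε-homo = ∙-cancelˡ (f ε) _ _ (begin
      f ε ∙ f ε  ≈⟨ f-hom ε ε ⟨
      f (ε ∙ ε)  ≈⟨ f-cong (identityˡ ε) ⟩
      f ε        ≈⟨ identityʳ (f ε) ⟨
      f ε ∙ ε    ∎)

    ⁻¹-homo : ∀ a → f (a ⁻¹) ≈ f a ⁻¹
    ⁻¹-homo a = inverseʳ-unique (f a) (f (a ⁻¹)) (begin
      f a ∙ f (a ⁻¹) ≈⟨ f-hom a (a ⁻¹) ⟨
      f (a ∙ a ⁻¹)   ≈⟨ f-cong (inverseʳ a) ⟩
      f ε            ≈⟨ ε-homo ⟩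
      ε              ∎)

    Kernel : Carrier → Set (c ⊔ ℓ)
    Kernel a = Lift c (f a ≈ ε)

    kernel-normal : IsNormalSubgroup X Kernel
    kernel-normal = record
      { resp = λ a≈b (lift fa≈ε) → lift (trans (f-cong (sym a≈b)) fa≈ε)
      ; has-ε = lift ε-homo
      ; ∙-closed = λ {a} {b} (lift fa≈ε) (lift fb≈ε) →
          lift (trans (f-hom a b) (trans (∙-cong fa≈ε fb≈ε) (identityˡ ε)))
      ; ⁻¹-closed = λ {a} (lift fa≈ε) → lift (trans (⁻¹-homo a) (trans (⁻¹-cong fa≈ε) ε⁻¹≈ε))
      ; conj-closed = λ g {a} (lift fa≈ε) → lift (begin
          f ((g ∙ a) ∙ g ⁻¹)        ≈⟨ f-hom _ _ ⟩
          f (g ∙ a) ∙ f (g ⁻¹)      ≈⟨ ∙-cong (f-hom g a) (⁻¹-homo g) ⟩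
          (f g ∙ f a) ∙ f g ⁻¹      ≈⟨ conj-ε (f g) fa≈ε ⟩
          ε                         ∎)
      }

  Trivial : Carrier → Set (c ⊔ ℓ)
  Trivial = Endomorphism.Kernel {id} id (λ _ _ → refl)

  trivial-normal : IsNormalSubgroup X Trivial
  trivial-normal = Endomorphism.kernel-normal {id} id (λ _ _ → refl)

  ⊎-const-normal : ∀ {N} (Q : Set (c ⊔ ℓ)) → IsNormalSubgroup X N →
                   IsNormalSubgroup X (λ a → N a ⊎ Q)
  ⊎-const-normal Q N-normal = record
    { resp = λ a≈b → map₁ (resp a≈b)
    ; has-ε = inj₁ has-ε
    ; ∙-closed = λ { (inj₁ n) (inj₁ n′) → inj₁ (∙-closed n n′) ; (inj₁ _) (inj₂ q) → inj₂ q ; (inj₂ q) _ → inj₂ q }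
    ; ⁻¹-closed = map₁ ⁻¹-closed
    ; conj-closed = λ g → map₁ (conj-closed g)
    }
    where
    open IsNormalSubgroup N-normal

  module SimpleGroup (simple : IsSimpleGroup X) where
    private
      a₀ : Carrier
      a₀ = proj₁ (proj₁ simple)
      a₀≉ε : ¬ a₀ ≈ ε
      a₀≉ε = proj₂ (proj₁ simple)

    excluded-middle : (Q : Set (c ⊔ ℓ)) → Q ⊎ ¬ Q
    excluded-middle Q with proj₂ simple _ (⊎-const-normal Q trivial-normal)
    ... | inj₁ trivial = inj₂ λ q → a₀≉ε (trivial a₀ (inj₂ q))
    ... | inj₂ everything with everything a₀
    ...   | inj₁ (lift a₀≈ε) = ⊥-elim (a₀≉ε a₀≈ε)
    ...   | inj₂ q = inj₁ q

    _≈?_ : Decidable _≈_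
    a ≈? b with excluded-middle (Lift c (a ≈ b))
    ... | inj₁ (lift a≈b) = yes a≈b
    ... | inj₂ a≉b = no λ a≈b → a≉b (lift a≈b)

    surjective-endo⇒injective :
      ∀ {f} (f-cong : ∀ {a b} → a ≈ b → f a ≈ f b) (f-hom : ∀ a b → f (a ∙ b) ≈ f a ∙ f b) →
      (∀ b → Σ Carrier λ a → f a ≈ b) → ∀ {a b} → f a ≈ f b → a ≈ b
    surjective-endo⇒injective {f} f-cong f-hom surj {a} {b} fa≈fb
      with proj₂ simple _ (Endomorphism.kernel-normal {f} f-cong f-hom)
    ... | inj₁ trivial-kernel = x∙y⁻¹≈ε⇒x≈y a b (trivial-kernel _ (lift (begin
          f (a ∙ b ⁻¹)   ≈⟨ f-hom a (b ⁻¹) ⟩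
          f a ∙ f (b ⁻¹) ≈⟨ ∙-congˡ (Endomorphism.⁻¹-homo {f} f-cong f-hom b) ⟩
          f a ∙ f b ⁻¹   ≈⟨ x≈y⇒x∙y⁻¹≈ε fa≈fb ⟩
          ε              ∎)))
    ... | inj₂ everything = ⊥-elim (a₀≉ε (begin
          a₀                  ≈⟨ proj₂ (surj a₀) ⟨
          f (proj₁ (surj a₀)) ≈⟨ lower (everything (proj₁ (surj a₀))) ⟩
          ε                   ∎))

module Evaluation {c ℓ} (X : Group c ℓ) where
  open Group X
  open import Algebra.Properties.Group X
  open import Relation.Binary.Reasoning.Setoid setoid

  -- The map Δ⁺ → X induced by rᵢ rⱼ ↦ sᵢ sⱼ⁻¹.  Odd words lie outside Δ⁺; their value
  -- (like that of Defs.act) is junk.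
  evalΔ : (Fin 3 → Carrier) → ΔWord → Carrier
  evalΔ s [] = ε
  evalΔ s (a ∷ []) = ε
  evalΔ s (a ∷ b ∷ w) = (s a ∙ s b ⁻¹) ∙ evalΔ s w

  _⁻¹ₛ : (Fin 3 → Carrier) → Fin 3 → Carrier
  (s ⁻¹ₛ) j = s j ⁻¹

  Onto : (Fin 3 → Carrier) → Set (c ⊔ ℓ)
  Onto s = ∀ a → Σ ΔWord λ k → Even k × evalΔ s k ≈ a

  module _ (s : Fin 3 → Carrier) where

    evalΔ-++ : ∀ {u} → Even u → ∀ v → evalΔ s (u ++ v) ≈ evalΔ s u ∙ evalΔ s v
    evalΔ-++ nil v = sym (identityˡ _)
    evalΔ-++ (cons₂ a b e) v = trans (∙-congˡ (evalΔ-++ e v)) (sym (assoc _ _ _))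

    evalΔ-reverse : ∀ {w} → Even w → evalΔ s (reverse w) ≈ evalΔ s w ⁻¹
    evalΔ-reverse nil = sym ε⁻¹≈ε
    evalΔ-reverse (cons₂ a b {w} e) = begin
      evalΔ s (reverse (a ∷ b ∷ w))               ≡⟨ ≡.cong (evalΔ s) (reverse-∷₂ a b w) ⟩
      evalΔ s (reverse w ++ b ∷ a ∷ [])           ≈⟨ evalΔ-++ (Even-reverse e) _ ⟩
      evalΔ s (reverse w) ∙ ((s b ∙ s a ⁻¹) ∙ ε)  ≈⟨ ∙-cong (evalΔ-reverse e) (identityʳ _) ⟩
      evalΔ s w ⁻¹ ∙ (s b ∙ s a ⁻¹)               ≈⟨ ∙-congˡ (∙-congʳ (⁻¹-involutive (s b))) ⟨
      evalΔ s w ⁻¹ ∙ (s b ⁻¹ ⁻¹ ∙ s a ⁻¹)         ≈⟨ ∙-congˡ (⁻¹-anti-homo-∙ (s a) (s b ⁻¹)) ⟨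
      evalΔ s w ⁻¹ ∙ (s a ∙ s b ⁻¹) ⁻¹            ≈⟨ ⁻¹-anti-homo-∙ _ _ ⟨
      ((s a ∙ s b ⁻¹) ∙ evalΔ s w) ⁻¹             ∎

    evalΔ-conjugate : ∀ {u k} → Even u → Even k →
                      evalΔ s (u ++ k ++ reverse u) ≈ (evalΔ s u ∙ evalΔ s k) ∙ evalΔ s u ⁻¹
    evalΔ-conjugate {u} {k} eu ek = begin
      evalΔ s (u ++ k ++ reverse u)                   ≈⟨ evalΔ-++ eu _ ⟩
      evalΔ s u ∙ evalΔ s (k ++ reverse u)            ≈⟨ ∙-congˡ (evalΔ-++ ek _) ⟩
      evalΔ s u ∙ (evalΔ s k ∙ evalΔ s (reverse u))   ≈⟨ assoc _ _ _ ⟨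
      (evalΔ s u ∙ evalΔ s k) ∙ evalΔ s (reverse u)   ≈⟨ ∙-congˡ (evalΔ-reverse eu) ⟩
      (evalΔ s u ∙ evalΔ s k) ∙ evalΔ s u ⁻¹          ∎

    evalΔ-wrap : ∀ a b {k} → Even k → evalΔ s (a ∷ k ++ [ b ]) ≈ (s a ∙ evalΔ (s ⁻¹ₛ) k) ∙ s b ⁻¹
    evalΔ-wrap a b nil = begin
      (s a ∙ s b ⁻¹) ∙ ε   ≈⟨ identityʳ _ ⟩
      s a ∙ s b ⁻¹         ≈⟨ ∙-congʳ (identityʳ _) ⟨
      (s a ∙ ε) ∙ s b ⁻¹   ∎
    evalΔ-wrap a b (cons₂ a′ b′ {w} e) = begin
      (s a ∙ s a′ ⁻¹) ∙ evalΔ s (b′ ∷ w ++ [ b ])              ≈⟨ ∙-congˡ (evalΔ-wrap b′ b e) ⟩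
      (s a ∙ s a′ ⁻¹) ∙ ((s b′ ∙ evalΔ (s ⁻¹ₛ) w) ∙ s b ⁻¹)    ≈⟨ assoc _ _ _ ⟨
      ((s a ∙ s a′ ⁻¹) ∙ (s b′ ∙ evalΔ (s ⁻¹ₛ) w)) ∙ s b ⁻¹    ≈⟨ ∙-congʳ (assoc _ _ _) ⟩
      (s a ∙ (s a′ ⁻¹ ∙ (s b′ ∙ evalΔ (s ⁻¹ₛ) w))) ∙ s b ⁻¹    ≈⟨ ∙-congʳ (∙-congˡ (assoc _ _ _)) ⟨
      (s a ∙ ((s a′ ⁻¹ ∙ s b′) ∙ evalΔ (s ⁻¹ₛ) w)) ∙ s b ⁻¹    ≈⟨ ∙-congʳ (∙-congˡ (∙-congʳ (∙-congˡ (⁻¹-involutive (s b′))))) ⟨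
      (s a ∙ evalΔ (s ⁻¹ₛ) (a′ ∷ b′ ∷ w)) ∙ s b ⁻¹             ∎

    module _ {x y u v} (eu : Even u) (u↦x : evalΔ s u ≈ x) (ev : Even v) (v↦y : evalΔ s v ≈ y) where

      private
        Realised : Carrier → Set ℓ
        Realised a = Σ ΔWord λ k → Even k × evalΔ s k ≈ a

        prepend : ∀ {t z a} → Even t → evalΔ s t ≈ z → Realised a → Realised (z ∙ a)
        prepend {t} et t↦z (k , ek , k↦a) = t ++ k , Even-++ et ek , trans (evalΔ-++ et k) (∙-cong t↦z k↦a)

        prepend⁻¹ : ∀ {t z a} → Even t → evalΔ s t ≈ z → Realised a → Realised (z ⁻¹ ∙ a)
        prepend⁻¹ et t↦z = prepend (Even-reverse et) (trans (evalΔ-reverse et) (⁻¹-cong t↦z))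

      evalΔ-eval₂ : ∀ w → Σ ΔWord λ k → Even k × evalΔ s k ≈ eval₂ X x y w
      evalΔ-eval₂ [] = [] , nil , refl
      evalΔ-eval₂ ((zero , true) ∷ w) = prepend eu u↦x (evalΔ-eval₂ w)
      evalΔ-eval₂ ((zero , false) ∷ w) = prepend⁻¹ eu u↦x (evalΔ-eval₂ w)
      evalΔ-eval₂ ((suc _ , true) ∷ w) = prepend ev v↦y (evalΔ-eval₂ w)
      evalΔ-eval₂ ((suc _ , false) ∷ w) = prepend⁻¹ ev v↦y (evalΔ-eval₂ w)

      generators⇒onto : Generates X x y → Onto s
      generators⇒onto generates a with generates a
      ... | w , a≈w with evalΔ-eval₂ w
      ...   | k , ek , k↦w = k , ek , trans k↦w (sym a≈w)

module _ {c ℓ} (X : Group c ℓ) where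
  open Group X
  open Evaluation X
  open import Algebra.Properties.Group X
  open import Relation.Binary.Reasoning.Setoid setoid

  ImageOfKernel : (s t : Fin 3 → Carrier) → Carrier → Set (c ⊔ ℓ)
  ImageOfKernel s t a = Lift c (Σ ΔWord λ k → Even k × evalΔ t k ≈ ε × evalΔ s k ≈ a)

  imageOfKernel-normal : ∀ {s} t → Onto s → IsNormalSubgroup X (ImageOfKernel s t)
  imageOfKernel-normal {s} t s-onto = record
    { resp = λ { a≈b (lift (k , ek , t↦ε , s↦a)) → lift (k , ek , t↦ε , trans s↦a a≈b) }
    ; has-ε = lift ([] , nil , refl , refl)
    ; ∙-closed = λ { (lift (k , ek , t↦ε , s↦a)) (lift (k′ , ek′ , t↦ε′ , s↦a′)) →
        lift (k ++ k′ , Even-++ ek ek′ ,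
              trans (evalΔ-++ t ek k′) (trans (∙-cong t↦ε t↦ε′) (identityˡ ε)) ,
              trans (evalΔ-++ s ek k′) (∙-cong s↦a s↦a′)) }
    ; ⁻¹-closed = λ { (lift (k , ek , t↦ε , s↦a)) →
        lift (reverse k , Even-reverse ek ,
              trans (evalΔ-reverse t ek) (trans (⁻¹-cong t↦ε) ε⁻¹≈ε) ,
              trans (evalΔ-reverse s ek) (⁻¹-cong s↦a)) }
    ; conj-closed = λ { g (lift (k , ek , t↦ε , s↦a)) → conjugate g k ek t↦ε s↦a }
    }
    where
    conjugate : ∀ g {a} k → Even k → evalΔ t k ≈ ε → evalΔ s k ≈ a →
                ImageOfKernel s t ((g ∙ a) ∙ g ⁻¹)
    conjugate g k ek t↦ε s↦a with s-onto g
    ... | u , eu , s↦g = lift (u ++ k ++ reverse u ,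
          Even-++ eu (Even-++ ek (Even-reverse eu)) ,
          trans (evalΔ-conjugate t eu ek) (conj-ε X _ t↦ε) ,
          trans (evalΔ-conjugate s eu ek) (∙-cong (∙-cong s↦g s↦a) (⁻¹-cong s↦g)))

  module _ (simple : IsSimpleGroup X) {s t : Fin 3 → Carrier} (s-onto : Onto s) (t-onto : Onto t)
           (trivial : ∀ a → ImageOfKernel s t a → a ≈ ε) where

    private
      P Q : ΔWord → Carrier
      P = evalΔ s
      Q = evalΔ t

      Q≈⇒P≈ : ∀ {k k′} → Even k → Even k′ → Q k ≈ Q k′ → P k ≈ P k′
      Q≈⇒P≈ {k} {k′} ek ek′ Qk≈Qk′ = x∙y⁻¹≈ε⇒x≈y _ _ (begin
        P k ∙ P k′ ⁻¹          ≈⟨ ∙-congˡ (evalΔ-reverse s ek′) ⟨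
        P k ∙ P (reverse k′)   ≈⟨ evalΔ-++ s ek _ ⟨
        P (k ++ reverse k′)    ≈⟨ trivial _ (lift (k ++ reverse k′ , ekk′ , Q↦ε , refl)) ⟩
        ε                      ∎)
        where
        ekk′ : Even (k ++ reverse k′)
        ekk′ = Even-++ ek (Even-reverse ek′)
        Q↦ε : Q (k ++ reverse k′) ≈ ε
        Q↦ε = begin
          Q (k ++ reverse k′)    ≈⟨ evalΔ-++ t ek _ ⟩
          Q k ∙ Q (reverse k′)   ≈⟨ ∙-congˡ (evalΔ-reverse t ek′) ⟩
          Q k ∙ Q k′ ⁻¹          ≈⟨ x≈y⇒x∙y⁻¹≈ε Qk≈Qk′ ⟩
          ε                      ∎

      G : Carrier → Carrier
      G a = P (proj₁ (t-onto a))

      G-spec : ∀ {k} → Even k → G (Q k) ≈ P k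
      G-spec ek = Q≈⇒P≈ (proj₁ (proj₂ (t-onto _))) ek (proj₂ (proj₂ (t-onto _)))

      G-cong : ∀ {a b} → a ≈ b → G a ≈ G b
      G-cong {a} {b} a≈b = Q≈⇒P≈ (proj₁ (proj₂ (t-onto a))) (proj₁ (proj₂ (t-onto b)))
        (trans (proj₂ (proj₂ (t-onto a))) (trans a≈b (sym (proj₂ (proj₂ (t-onto b))))))

      G-hom : ∀ a b → G (a ∙ b) ≈ G a ∙ G b
      G-hom a b = begin
        G (a ∙ b)          ≈⟨ G-cong (∙-cong Qk≈a Qk′≈b) ⟨
        G (Q k ∙ Q k′)     ≈⟨ G-cong (evalΔ-++ t ek k′) ⟨
        G (Q (k ++ k′))    ≈⟨ G-spec (Even-++ ek ek′) ⟩
        P (k ++ k′)        ≈⟨ evalΔ-++ s ek k′ ⟩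
        P k ∙ P k′         ≈⟨ ∙-cong (G-spec ek) (G-spec ek′) ⟨
        G (Q k) ∙ G (Q k′) ≈⟨ ∙-cong (G-cong Qk≈a) (G-cong Qk′≈b) ⟩
        G a ∙ G b          ∎
        where
        k k′ : ΔWord
        k = proj₁ (t-onto a)
        k′ = proj₁ (t-onto b)
        ek : Even k
        ek = proj₁ (proj₂ (t-onto a))
        ek′ : Even k′
        ek′ = proj₁ (proj₂ (t-onto b))
        Qk≈a : Q k ≈ a
        Qk≈a = proj₂ (proj₂ (t-onto a))
        Qk′≈b : Q k′ ≈ b
        Qk′≈b = proj₂ (proj₂ (t-onto b))

      G-surjective : ∀ b → Σ Carrier λ a → G a ≈ b
      G-surjective b with s-onto b
      ... | k , ek , Pk≈b = Q k , trans (G-spec ek) Pk≈b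

      G-automorphism : IsAutomorphism X G
      G-automorphism = record
        { cong-f = G-cong
        ; hom = G-hom
        ; inj = SimpleGroup.surjective-endo⇒injective X simple G-cong G-hom G-surjective
        ; surj = G-surjective
        }

      G-inverts : ∀ {u z} → Even u → P u ≈ z → Q u ≈ z ⁻¹ → G z ≈ z ⁻¹
      G-inverts {u} {z} eu Pu≈z Qu≈z⁻¹ = begin
        G z          ≈⟨ G-cong (⁻¹-involutive z) ⟨
        G (z ⁻¹ ⁻¹)  ≈⟨ Endomorphism.⁻¹-homo X G-cong G-hom (z ⁻¹) ⟩
        G (z ⁻¹) ⁻¹  ≈⟨ ⁻¹-cong (G-cong Qu≈z⁻¹) ⟨
        G (Q u) ⁻¹   ≈⟨ ⁻¹-cong (G-spec eu) ⟩
        P u ⁻¹       ≈⟨ ⁻¹-cong Pu≈z ⟩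
        z ⁻¹         ∎

    trivial-imageOfKernel⇒symmetric :
      ∀ {x y u v} → Even u → evalΔ s u ≈ x → evalΔ t u ≈ x ⁻¹ →
      Even v → evalΔ s v ≈ y → evalΔ t v ≈ y ⁻¹ → IsSymmetricPair X x y
    trivial-imageOfKernel⇒symmetric eu Pu≈x Qu≈x⁻¹ ev Pv≈y Qv≈y⁻¹ =
      G , G-automorphism , G-inverts eu Pu≈x Qu≈x⁻¹ , G-inverts ev Pv≈y Qv≈y⁻¹

module LeftRegular {c ℓ} (X : Group c ℓ) (E : Enumeration (Group.setoid X)) where
  open Group X
  open Enumeration E
  open import Algebra.Properties.Group X

  infixr 5 _·_
  _·_ : Carrier → Fin size → Fin size
  a · d = index (a ∙ elem d)

  ·-cong : ∀ {a b} → a ≈ b → ∀ d → a · d ≡ b · d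
  ·-cong a≈b d = index-cong (∙-congʳ a≈b)

  ∙-· : ∀ a b d → (a ∙ b) · d ≡ a · b · d
  ∙-· a b d = index-cong (trans (assoc a b (elem d)) (∙-congˡ (sym (elem-index _))))

  ε-· : ∀ d → ε · d ≡ d
  ε-· d = ≡.trans (index-cong (identityˡ _)) (index-elem d)

  ·-faithful : ∀ {a b} → (∀ d → a · d ≡ b · d) → a ≈ b
  ·-faithful {a} {b} a·≗b· = ∙-cancelʳ (elem d) a b (index-injective (a·≗b· d))
    where d = index ε

  ·-transitive : ∀ d e → (elem e ∙ elem d ⁻¹) · d ≡ e
  ·-transitive d e = ≡.trans (index-cong (trans (assoc _ _ _)
    (trans (∙-congˡ (inverseˡ _)) (identityʳ _)))) (index-elem e)

  ·-inverse : ∀ {a b} → a ∙ b ≈ ε → ∀ d → a · b · d ≡ d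
  ·-inverse {a} {b} a∙b≈ε d = ≡.trans (≡.sym (∙-· a b d)) (≡.trans (·-cong a∙b≈ε d) (ε-· d))

  leftPerm : Carrier → Permutation′ size
  leftPerm a = permutation (a ·_) (a ⁻¹ ·_) (·-inverse (inverseʳ a)) (·-inverse (inverseˡ a))

  infixl 5 _◃_
  _◃_ : Fin size → Carrier → Fin size
  d ◃ b = index (elem d ∙ b)

  ◃-∙ : ∀ d a b → d ◃ a ◃ b ≡ d ◃ (a ∙ b)
  ◃-∙ d a b = index-cong (trans (∙-congʳ (elem-index _)) (assoc (elem d) a b))

  ◃-inverse : ∀ {a b} → a ∙ b ≈ ε → ∀ d → d ◃ a ◃ b ≡ d
  ◃-inverse {a} {b} a∙b≈ε d = ≡.trans (◃-∙ d a b)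
    (≡.trans (index-cong (trans (∙-congˡ a∙b≈ε) (identityʳ _))) (index-elem d))

  ◃-transitive : ∀ d e → d ◃ (elem d ⁻¹ ∙ elem e) ≡ e
  ◃-transitive d e = ≡.trans (index-cong (trans (sym (assoc _ _ _))
    (trans (∙-congʳ (inverseʳ _)) (identityˡ _)))) (index-elem e)

  ·-◃-commute : ∀ a b d → (a · d) ◃ b ≡ a · (d ◃ b)
  ·-◃-commute a b d = index-cong (trans (∙-congʳ (elem-index _))
    (trans (assoc a (elem d) b) (∙-congˡ (sym (elem-index _)))))

  rightPerm : Carrier → Permutation′ size
  rightPerm b = permutation (_◃ b) (_◃ b ⁻¹) (◃-inverse (inverseˡ b)) (◃-inverse (inverseʳ b))

  rightPerm-commutes : ∀ a b → Commute (rightPerm b) (leftPerm a)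
  rightPerm-commutes a b = ·-◃-commute a b

module RegularHypermap {c ℓ} (X : Group c ℓ) (E : Enumeration (Group.setoid X))
                       {x y : Group.Carrier X} (generates : Generates X x y) where
  open Group X
  open Enumeration E
  open LeftRegular X E
  open Evaluation X
  open import Algebra.Properties.Group X

  𝓗 : Hypermap
  𝓗 = hypermap size (leftPerm x) (leftPerm y)

  -- θ j is the element of X acting as sⱼ in Defs.sInv (s₀ = L⁻¹, s₁ = R, s₂ = 1).
  θ : Fin 3 → Carrier
  θ zero = y ⁻¹
  θ (suc zero) = x
  θ (suc (suc _)) = ε

  sInv-· : ∀ j d → sInv 𝓗 j d ≡ θ j ⁻¹ · d
  sInv-· zero d = ·-cong (sym (⁻¹-involutive y)) d
  sInv-· (suc zero) d = ≡.refl
  sInv-· (suc (suc _)) d = ≡.sym (≡.trans (·-cong ε⁻¹≈ε d) (ε-· d))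

  pairAct-· : ∀ a b d → pairAct 𝓗 a b d ≡ (θ a ∙ θ b ⁻¹) · d
  pairAct-· a b d = ≡.trans (θa-· a)
    (≡.trans (≡.cong (θ a ·_) (sInv-· b d)) (≡.sym (∙-· (θ a) (θ b ⁻¹) d)))
    where
    θa-· : ∀ a → pairAct 𝓗 a b d ≡ θ a · sInv 𝓗 b d
    θa-· zero = ≡.refl
    θa-· (suc zero) = ≡.refl
    θa-· (suc (suc _)) = ≡.sym (ε-· _)

  act-· : ∀ w d → act 𝓗 w d ≡ evalΔ θ w · d
  act-· [] d = ≡.sym (ε-· d)
  act-· (a ∷ []) d = ≡.sym (ε-· d)
  act-· (a ∷ b ∷ w) d = ≡.trans (pairAct-· a b _)
    (≡.trans (≡.cong (_ ·_) (act-· w d)) (≡.sym (∙-· _ _ d)))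

  ρ-even : Even ρΔ
  ρ-even = cons₂ r₁ r₂ nil

  λ-even : Even λΔ
  λ-even = cons₂ r₂ r₀ nil

  θ-ρ : evalΔ θ ρΔ ≈ x
  θ-ρ = trans (identityʳ _) (trans (∙-congˡ ε⁻¹≈ε) (identityʳ x))

  θ-λ : evalΔ θ λΔ ≈ y
  θ-λ = trans (identityʳ _) (trans (identityˡ _) (⁻¹-involutive y))

  θ⁻¹-ρ : evalΔ (θ ⁻¹ₛ) ρΔ ≈ x ⁻¹
  θ⁻¹-ρ = trans (identityʳ _) (trans (∙-congˡ (⁻¹-involutive ε)) (identityʳ _))

  θ⁻¹-λ : evalΔ (θ ⁻¹ₛ) λΔ ≈ y ⁻¹
  θ⁻¹-λ = trans (identityʳ _) (trans (∙-cong ε⁻¹≈ε (⁻¹-involutive _)) (identityˡ _))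

  θ-onto : Onto θ
  θ-onto = generators⇒onto θ ρ-even θ-ρ λ-even θ-λ generates

  θ⁻¹-onto : Onto (θ ⁻¹ₛ)
  θ⁻¹-onto = generators⇒onto (θ ⁻¹ₛ)
    (Even-reverse ρ-even) (reverse-inverts (θ ⁻¹ₛ) ρΔ ρ-even θ⁻¹-ρ)
    (Even-reverse λ-even) (reverse-inverts (θ ⁻¹ₛ) λΔ λ-even θ⁻¹-λ)
    generates
    where
    reverse-inverts : ∀ s u → Even u → ∀ {z} → evalΔ s u ≈ z ⁻¹ → evalΔ s (reverse u) ≈ z
    reverse-inverts s u eu u↦z⁻¹ = trans (evalΔ-reverse s eu) (trans (⁻¹-cong u↦z⁻¹) (⁻¹-involutive _))

  transitive : IsTransitive 𝓗
  transitive d e = k , Even⇒IsEven ek , (begin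
    act 𝓗 k d                 ≡⟨ act-· k d ⟩
    evalΔ θ k · d             ≡⟨ ·-cong k↦ d ⟩
    (elem e ∙ elem d ⁻¹) · d  ≡⟨ ·-transitive d e ⟩
    e                         ∎)
    where
    open ≡.≡-Reasoning
    k : ΔWord
    k = proj₁ (θ-onto (elem e ∙ elem d ⁻¹))
    ek : Even k
    ek = proj₁ (proj₂ (θ-onto _))
    k↦ : evalΔ θ k ≈ elem e ∙ elem d ⁻¹
    k↦ = proj₂ (proj₂ (θ-onto _))

  orientably-regular : IsOrientablyRegular 𝓗
  orientably-regular =
      (λ d e → rightPerm (elem d ⁻¹ ∙ elem e) , rightPerm-aut _ , ◃-transitive d e)
    , (λ σ d σ-aut σd≡d → aut-fixing-dart⇒id 𝓗 transitive {σ} σ-aut σd≡d)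
    where
    rightPerm-aut : ∀ b → IsHypermapAut 𝓗 (rightPerm b)
    rightPerm-aut b d = rightPerm-commutes x b d , rightPerm-commutes y b d

  mon-isomorphic : MonIsomorphicTo 𝓗 X
  mon-isomorphic = _·_ , ·-cong , ∙-· , ·-faithful , realised , λ w _ → evalΔ θ w , act-· w
    where
    realised : ∀ a → Σ ΔWord λ w → IsEven w × (∀ d → a · d ≡ act 𝓗 w d)
    realised a with θ-onto a
    ... | k , ek , k↦a = k , Even⇒IsEven ek , λ d → ≡.trans (·-cong (sym k↦a) d) (≡.sym (act-· k d))

  evalΔ≈ε⇒InH : ∀ {w} → Even w → evalΔ θ w ≈ ε → InH 𝓗 w
  evalΔ≈ε⇒InH {w} ew w↦ε = Even⇒IsEven ew , λ d → begin
    act 𝓗 w d        ≡⟨ act-· w d ⟩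
    evalΔ θ w · d    ≡⟨ ·-cong w↦ε d ⟩
    ε · d            ≡⟨ ε-· d ⟩
    d                ∎
    where open ≡.≡-Reasoning

  -- As θ r₂ = ε, conjugation by r₂ replaces θ by θ ⁻¹ₛ; hence H^r = ker (evalΔ (θ ⁻¹ₛ)).
  evalΔ-conj-r₂ : ∀ {k} → Even k → evalΔ θ (r₂ ∷ k ++ [ r₂ ]) ≈ evalΔ (θ ⁻¹ₛ) k
  evalΔ-conj-r₂ ek = trans (evalΔ-wrap θ r₂ r₂ ek)
    (trans (∙-cong (identityˡ _) ε⁻¹≈ε) (identityʳ _))

  module _ (simple : IsSimpleGroup X) (asymmetric : ¬ IsSymmetricPair X x y) where

    imageOfKernel-everything : ∀ a → ImageOfKernel X θ (θ ⁻¹ₛ) a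
    imageOfKernel-everything with proj₂ simple _ (imageOfKernel-normal X (θ ⁻¹ₛ) θ-onto)
    ... | inj₂ everything = everything
    ... | inj₁ trivial = ⊥-elim (asymmetric
      (trivial-imageOfKernel⇒symmetric X simple θ-onto θ⁻¹-onto trivial
        ρ-even θ-ρ θ⁻¹-ρ λ-even θ-λ θ⁻¹-λ))

    totally-chiral : IsTotallyChiral 𝓗
    totally-chiral = orientably-regular , factorise
      where
      factorise : ∀ w → IsEven w → Σ ΔWord λ h → Σ ΔWord λ k →
                  InH 𝓗 h × InHr 𝓗 k × (w ≈Δ (h ++ k))
      factorise w w-even with imageOfKernel-everything (evalΔ θ w)
      ... | lift (k , ek , Qk≈ε , Pk≈Pw) =
        w ++ reverse k , k ,
        evalΔ≈ε⇒InH (Even-++ ew (Even-reverse ek)) h↦ε ,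
        (Even⇒IsEven ek , evalΔ≈ε⇒InH (Even-wrap r₂ r₂ ek) (trans (evalΔ-conj-r₂ ek) Qk≈ε)) ,
        ≈Δ-split w k
        where
        ew : Even w
        ew = IsEven⇒Even w w-even
        h↦ε : evalΔ θ (w ++ reverse k) ≈ ε
        h↦ε = trans (evalΔ-++ θ ew _)
          (trans (∙-congˡ (evalΔ-reverse θ ek)) (x≈y⇒x∙y⁻¹≈ε (sym Pk≈Pw)))

lemma11 : {c ℓ : Level} (X : Group c ℓ) → IsFiniteGroup X → IsSimpleGroup X →
          HasAsymmetricGeneratingPair X →
          Σ Hypermap λ 𝓗 → IsTransitive 𝓗 × IsTotallyChiral 𝓗 × MonIsomorphicTo 𝓗 X
lemma11 X (n , f , covers) simple (x , y , generates , asymmetric) =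
  𝓗 , transitive , totally-chiral simple asymmetric , mon-isomorphic
  where
  open RegularHypermap X (enumerate (Group.setoid X) (SimpleGroup._≈?_ X simple) n f covers) generates
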